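{- Let $(\Sigma, I, \to, \preceq)$ be a well-structured transition system and let $P \subseteq \Sigma$ be a downward-closed set. If the rule system described in the context admits a derivation $\mathsf{Init} \mapsto^{*} \mathsf{valid}$, then $\mathrm{Cover} \subseteq P$.
   Context: A well-structured transition system (WSTS) $(\Sigma, I, \to, \preceq)$ consists of a set $\Sigma$ of states, a finite set $I \subseteq \Sigma$ of initial states, a relation $\to \subseteq \Sigma \times \Sigma$, and a well-quasi-order $\preceq$ on $\Sigma$ such that whenever $s_1 \to s_2$ and $s_1 \preceq t_1$, there is $t_2$ with $t_1 \to^{*} t_2$ and $s_2 \preceq t_2$. For $Y \subseteq \Sigma$, $\uparrow Y = \{x \mid \exists y \in Y,\ y \preceq x\}$ and $\downarrow Y = \{x \mid \exists y \in Y,\ x \preceq y\}$; $\uparrow x = \uparrow\{x\}$. For $X \subseteq \Sigma$, $\mathrm{pre}(X) = \{y \mid \exists x \in X,\ y \to x\}$ and $\mathrm{post}(X) = \{y \mid \exists x \in X,\ x \to y\}$. $\mathrm{Reach}$ is the set of states reachable from $I$ via $\to^{*}$, and $\mathrm{Cover} = \downarrow \mathrm{Reach}$. The rule system (generic version). Its states are $\mathsf{Init}$, $\mathsf{valid}$, $\mathsf{invalid}$, and pairs $\mathbf{R} \mid Q$ where $\mathbf{R} = (R_0, \ldots, R_N)$ ($N \ge 0$, called the length) is a vector of downward-closed subsets of $\Sigma$ and $Q$ is a finite priority queue of pairs $\langle a, i\rangle \in \Sigma \times \mathbb{N}$ with priority $i$; $\min Q$ is an element of least priority, $\mathrm{popMin}(Q)$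 is $Q$ with that element removed, $\mathrm{push}(Q,x)$ is $Q$ with $x$ added. For $0 \le i \le N$ and $a \in \Sigma$ let $\mathrm{Gen}_i(a) = \{ b \mid b \preceq a,\ \uparrow b \cap I = \emptyset,\ \mathrm{pre}(\uparrow b) \cap (R_i \setminus \uparrow b) = \emptyset\}$. $\mathbf{R}[R_k \gets R'_k]_{k=1}^i$ denotes $(R_0, R'_1, \ldots, R'_i, R_{i+1}, \ldots, R_N)$. The one-step relation $\mapsto$ is given by the rules: (Initialize) $\mathsf{Init} \mapsto (\downarrow I) \mid \emptyset$ (a vector of length $0$ with $R_0 = \downarrow I$). (CandidateNondet) if $a \in R_N \setminus P$: $\mathbf{R} \mid \emptyset \mapsto \mathbf{R} \mid \{\langle a, N\rangle\}$. (ModelSyn) if $\min Q = \langle a, 0\rangle$: $\mathbf{R}\mid Q \mapsto \mathsf{invalid}$. (ModelSem) if $\min Q = \langle a, i\rangle$ and $I \cap \uparrow a \neq \emptyset$: $\mathbf{R}\mid Q \mapsto \mathsf{invalid}$. (DecideNondet) if $\min Q = \langle a, i \rangle$, $i > 0$, $b \in \mathrm{pre}(\uparrow a) \cap (R_{i-1} \setminus \uparrow a)$: $\mathbf{R}\mid Q \mapsto \mathbf{R} \mid \mathrm{push}(Q, \langle b, i-1\rangle)$. (Conflict) if $\min Q = \langle a, i\rangle$, $i>0$, $\mathrm{pre}(\uparrow a) \cap (R_{i-1}\setminus \uparrow a) = \emptyset$ and $b \in \mathrm{Gen}_{i-1}(a)$: $\mathbf{R}\mid Q \mapsto \mathbf{R}[R_k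 \gets R_k \setminus \uparrow b]_{k=1}^{i} \mid \mathrm{popMin}(Q)$. (Induction) if $R_i = \Sigma \setminus \uparrow\{r_{i,1}, \ldots, r_{i,m}\}$ and $b \in \mathrm{Gen}_i(r_{i,j})$ for some $1 \le j \le m$: $\mathbf{R} \mid \emptyset \mapsto \mathbf{R}[R_k \gets R_k \setminus \uparrow b]_{k=1}^{i+1} \mid \emptyset$. (Valid) if $R_i = R_{i+1}$ for some $i < N$: $\mathbf{R}\mid Q \mapsto \mathsf{valid}$. (Unfold) if $R_N \subseteq P$: $\mathbf{R} \mid \emptyset \mapsto (R_0, \ldots, R_N, \Sigma) \mid \emptyset$. $\mapsto^{*}$ is the reflexive-transitive closure of $\mapsto$. -}

module Defs where

open import Level using (0ℓ) renaming (suc to lsuc)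
open import Data.Nat using (ℕ; zero; suc; _≤_; _<_; _≤?_)
open import Data.Fin using (Fin; toℕ; fromℕ; inject₁)
open import Data.Vec using (Vec; []; _∷_; lookup; tabulate; _∷ʳ_; last)
open import Data.List using (List; []; _∷_; _++_)
open import Data.List.Membership.Propositional using (_∈_)
open import Data.List.Relation.Unary.All using (All)
open import Data.Product using (Σ; ∃; ∃-syntax; _×_; _,_)
open import Data.Unit using (⊤)
open import Data.Empty using (⊥)
open import Relation.Nullary using (¬_; yes; no)
open import Relation.Binary.PropositionalEquality using (_≡_)
open import Relation.Binary.Construct.Closure.ReflexiveTransitive using (Star)

record IsWQO {S : Set} (_≼_ : S → S → Set) : Set where
  field
    refl  : ∀ {x} → x ≼ x
    trans : ∀ {x y z} → x ≼ y → y ≼ z → x ≼ z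
    good  : ∀ (f : ℕ → S) → ∃[ i ] ∃[ j ] (i < j × f i ≼ f j)

record WSTS : Set₁ where
  field
    St    : Set
    Init  : List St
    _⟶_   : St → St → Set
    _≼_   : St → St → Set
    wqo   : IsWQO _≼_
    compat : ∀ {s₁ s₂ t₁} → s₁ ⟶ s₂ → s₁ ≼ t₁ →
             ∃[ t₂ ] (Star _⟶_ t₁ t₂ × s₂ ≼ t₂)

module _ (W : WSTS) where
  open WSTS W

  Pred : Set₁
  Pred = St → Set

  InI : Pred
  InI x = x ∈ Init

  DownClosed : Pred → Set
  DownClosed X = ∀ {x y} → x ≼ y → X y → X x

  Up : St → Pred
  Up b x = b ≼ x

  Pre : Pred → Pred
  Pre X y = ∃[ x ] (X x × (y ⟶ x))

  Reach : Pred
  Reach y = ∃[ s ] (InI s × Star _⟶_ s y)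

  Cover : Pred
  Cover x = ∃[ y ] (Reach y × x ≼ y)

  record DSet : Set₁ where
    constructor dset
    field
      mem  : Pred
      down : DownClosed mem
  open DSet public

  downI : DSet
  downI = dset (λ x → ∃[ y ] (InI y × x ≼ y))
               (λ x≼y (z , z∈I , y≼z) → z , z∈I , IsWQO.trans wqo x≼y y≼z)

  full : DSet
  full = dset (λ _ → ⊤) (λ _ _ → Data.Unit.tt)

  removeUp : DSet → St → DSet
  removeUp R b = dset (λ x → mem R x × ¬ (b ≼ x))
    (λ x≼y (Ry , b⋠y) → down R x≼y Ry , λ b≼x → b⋠y (IsWQO.trans wqo b≼x x≼y))

  Disjoint : Pred → Pred → Set
  Disjoint X Y = ∀ x → X x → Y x → ⊥

  _⊆_ : Pred → Pred → Set
  X ⊆ Y = ∀ x → X x → Y x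

  _≐_ : Pred → Pred → Set
  X ≐ Y = (X ⊆ Y) × (Y ⊆ X)

  -- vectors R = (R₀,…,R_N) of downward-closed sets, of length N (N+1 entries)
  Frames : ℕ → Set₁
  Frames N = Vec DSet (suc N)

  Gen : DSet → St → Pred
  Gen Ri a b = (b ≼ a)
             × ¬ (∃[ x ] (InI x × b ≼ x))
             × Disjoint (Pre (Up b)) (λ y → mem Ri y × ¬ (b ≼ y))

  update : ∀ {N} → Frames N → ℕ → St → Frames N
  update {N} R i b = tabulate λ k → upd k (1 ≤? toℕ k) (toℕ k ≤? i)
    where
    upd : (k : Fin (suc N)) → _ → _ → DSet
    upd k (yes _) (yes _) = removeUp (lookup R k) b
    upd k _       _       = lookup R k

  Queue : Set
  Queue = List (St × ℕ)

  priority : St × ℕ → ℕ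
  priority (_ , i) = i

  data IsMin (Q : Queue) (x : St × ℕ) (Q' : Queue) : Set where
    isMin : ∀ xs ys → Q ≡ xs ++ x ∷ ys → Q' ≡ xs ++ ys →
            All (λ y → priority x ≤ priority y) (xs ++ ys) → IsMin Q x Q'

  push : Queue → St × ℕ → Queue
  push Q x = x ∷ Q

  data RState : Set₁ where
    init    : RState
    valid   : RState
    invalid : RState
    conf    : (N : ℕ) → Frames N → Queue → RState

  module Rules (P : Pred) where

    data _↦_ : RState → RState → Set₁ where
      Initialize : init ↦ conf 0 (downI ∷ []) []

      CandidateNondet : ∀ {N} {R : Frames N} a →
        mem (last R) a → ¬ P a →
        conf N R [] ↦ conf N R ((a , N) ∷ [])

      ModelSyn : ∀ {N} {R : Frames N} {Q Q'} a →
        IsMin Q (a , 0) Q' →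
        conf N R Q ↦ invalid

      ModelSem : ∀ {N} {R : Frames N} {Q Q'} a i →
        IsMin Q (a , i) Q' →
        ∃[ x ] (InI x × a ≼ x) →
        conf N R Q ↦ invalid

      -- here i = suc (toℕ j), so R_{i-1} = lookup R j
      DecideNondet : ∀ {N} {R : Frames N} {Q Q'} a (j : Fin (suc N)) b →
        IsMin Q (a , suc (toℕ j)) Q' →
        Pre (Up a) b → mem (lookup R j) b → ¬ (a ≼ b) →
        conf N R Q ↦ conf N R (push Q (b , toℕ j))

      Conflict : ∀ {N} {R : Frames N} {Q Q'} a (j : Fin (suc N)) b →
        IsMin Q (a , suc (toℕ j)) Q' →
        Disjoint (Pre (Up a)) (λ y → mem (lookup R j) y × ¬ (a ≼ y)) →
        Gen (lookup R j) a b →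
        conf N R Q ↦ conf N (update R (suc (toℕ j)) b) Q'

      Induction : ∀ {N} {R : Frames N} (i : Fin (suc N)) (rs : List St) r b →
        mem (lookup R i) ≐ (λ x → ¬ (∃[ y ] (y ∈ rs × y ≼ x))) →
        r ∈ rs →
        Gen (lookup R i) r b →
        conf N R [] ↦ conf N (update R (suc (toℕ i)) b) []

      Valid : ∀ {N} {R : Frames N} {Q} (i : Fin N) →
        mem (lookup R (inject₁ i)) ≐ mem (lookup R (Data.Fin.suc i)) →
        conf N R Q ↦ valid

      Unfold : ∀ {N} {R : Frames N} →
        mem (last R) ⊆ P →
        conf N R [] ↦ conf (suc N) (R ∷ʳ full) []

    _↦*_ : RState → RState → Set₁
    _↦*_ = Star _↦_

-- Every configuration reachable from Init keeps its frames R₀, …, R_N in the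
-- shape of an IC3/PDR trace: R₀ = ↓I, Rₖ ⊆ Rₖ₊₁, post(Rₖ) ⊆ Rₖ₊₁ and Rₖ ⊆ P
-- for k < N.  Conflict and Induction remove a cone ↑b from R₁, …, Rᵢ only
-- when ↑b avoids I and no state of Rᵢ₋₁ outside ↑b steps into ↑b, which keeps
-- this shape; Unfold appends Σ only once R_N ⊆ P.  When Valid fires, Rᵢ = Rᵢ₊₁
-- is a downward-closed inductive invariant containing I and contained in P.
module Submission where

open import Defs
open import Data.Nat using (ℕ; zero; suc; _≤_; _<_; z≤n; s≤s; _≤?_; _<?_)
open import Data.Nat.Properties using (<⇒≤; ≤-pred; ≰⇒>; m<1+n⇒m<n∨m≡n; m≤n⇒m<n∨m≡n)
open import Data.Fin using (Fin; toℕ; fromℕ<; inject₁)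
open import Data.Fin.Properties using (toℕ<n; toℕ-fromℕ<; toℕ-inject₁)
open import Data.Vec using (Vec; []; _∷_; lookup; tabulate; _∷ʳ_; last)
open import Data.Vec.Properties using (lookup∘tabulate)
open import Data.Product using (∃-syntax; _×_; _,_; proj₁; proj₂)
open import Data.Sum using (inj₁; inj₂)
open import Data.Unit using (⊤; tt)
open import Data.Empty using (⊥-elim)
open import Function.Bundles using (_⇔_; mk⇔; Equivalence)
open import Relation.Nullary using (¬_; yes; no)
open import Relation.Binary.PropositionalEquality using (_≡_; refl; sym; subst)
open import Relation.Binary.Construct.Closure.ReflexiveTransitive using (Star; ε; _◅_)

open Equivalence using (to; from)

module _ (W : WSTS) where
  open WSTS W
  open IsWQO wqo using () renaming (refl to ≼-refl; trans to ≼-trans)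

  cover⊆inductive-invariant : ∀ {X : Pred W} → DownClosed W X →
    (∀ x → InI W x → X x) → (∀ x y → X x → x ⟶ y → X y) → _⊆_ W (Cover W) X
  cover⊆inductive-invariant {X} X-down I⊆X X-closed x (y , (s , s∈I , s⟶*y) , x≼y) =
    X-down x≼y (along s⟶*y (I⊆X s s∈I))
    where
    along : ∀ {u v} → Star _⟶_ u v → X u → X v
    along ε                Xu = Xu
    along (u⟶u′ ◅ u′⟶*v) Xu = along u′⟶*v (X-closed _ _ Xu u⟶u′)

  -- Frames indexed by ℕ; indices past the end denote Σ, matching the Σ that
  -- Unfold appends.
  frame : ∀ {n} → Vec (DSet W) n → ℕ → Pred W
  frame []       _       = λ _ → ⊤
  frame (R ∷ _)  zero    = mem R
  frame (_ ∷ Rs) (suc k) = frame Rs k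

  frame-lookup : ∀ {n} (Rs : Vec (DSet W) n) (f : Fin n) → frame Rs (toℕ f) ≡ mem (lookup Rs f)
  frame-lookup (_ ∷ _)  Fin.zero    = refl
  frame-lookup (_ ∷ Rs) (Fin.suc f) = frame-lookup Rs f

  frame-last : ∀ {N} (Rs : Frames W N) → frame Rs N ≡ mem (last Rs)
  frame-last {zero}  (_ ∷ [])  = refl
  frame-last {suc N} (_ ∷ Rs) = frame-last Rs

  frame-∷ʳ-full : ∀ {n} (Rs : Vec (DSet W) n) k → frame (Rs ∷ʳ full W) k ≡ frame Rs k
  frame-∷ʳ-full []       zero    = refl
  frame-∷ʳ-full []       (suc k) = refl
  frame-∷ʳ-full (_ ∷ Rs) zero    = refl
  frame-∷ʳ-full (_ ∷ Rs) (suc k) = frame-∷ʳ-full Rs k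

  frame-beyond : ∀ {n} (Rs : Vec (DSet W) n) {k} → n ≤ k → ∀ x → frame Rs k x
  frame-beyond []       _         _ = tt
  frame-beyond (_ ∷ Rs) (s≤s n≤k) x = frame-beyond Rs n≤k x

  frame-down : ∀ {n} (Rs : Vec (DSet W) n) k → DownClosed W (frame Rs k)
  frame-down []       _       = λ _ _ → tt
  frame-down (R ∷ _)  zero    = down R
  frame-down (_ ∷ Rs) (suc k) = frame-down Rs k

  -- update tabulates through a local function; this names it, so that
  -- lookup∘tabulate can expose the case split it performs.
  update-tabulate : ∀ {N} (Rs : Frames W N) i b →
    ∃[ g ] (update W Rs i b ≡ lookup Rs Fin.zero ∷ tabulate g)
  update-tabulate Rs i b = _ , refl

  lookup-update : ∀ {N} (Rs : Frames W N) i b (f : Fin (suc N)) x →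
    mem (lookup (update W Rs i b) f) x ⇔
    (mem (lookup Rs f) x × (1 ≤ toℕ f → toℕ f ≤ i → ¬ b ≼ x))
  lookup-update Rs i b Fin.zero    x = mk⇔ (λ Rx → Rx , λ ()) proj₁
  lookup-update Rs i b (Fin.suc f) x =
    subst Characterised (sym (lookup∘tabulate (proj₁ (update-tabulate Rs i b)) f)) cases
    where
    Characterised : DSet W → Set
    Characterised D = mem D x ⇔
      (mem (lookup Rs (Fin.suc f)) x × (1 ≤ suc (toℕ f) → suc (toℕ f) ≤ i → ¬ b ≼ x))

    cases : Characterised (proj₁ (update-tabulate Rs i b) f)
    cases with suc (toℕ f) ≤? i
    ... | yes f≤i = mk⇔ (λ (Rx , b⋠x) → Rx , λ _ _ → b⋠x) (λ (Rx , b⋠x) → Rx , b⋠x (s≤s z≤n) f≤i)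
    ... | no  f≰i = mk⇔ (λ Rx → Rx , λ _ f≤i → ⊥-elim (f≰i f≤i)) proj₁

  frame-update : ∀ {N} (Rs : Frames W N) i b k x →
    frame (update W Rs i b) k x ⇔ (frame Rs k x × (1 ≤ k → k ≤ i → k ≤ N → ¬ b ≼ x))
  frame-update {N} Rs i b k x with k <? suc N
  ... | no  k≮1+N = mk⇔ (λ _ → frame-beyond Rs N<k x , λ _ _ k≤N → ⊥-elim (k≮1+N (s≤s k≤N)))
                        (λ _ → frame-beyond (update W Rs i b) N<k x)
    where N<k = ≤-pred (≰⇒> k≮1+N)
  ... | yes k<1+N = subst Characterised (toℕ-fromℕ< k<1+N) (at-index (fromℕ< k<1+N))
    where
    Characterised : ℕ → Set
    Characterised k = frame (update W Rs i b) k x ⇔ (frame Rs k x × (1 ≤ k → k ≤ i → k ≤ N → ¬ b ≼ x))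

    at-index : ∀ f → Characterised (toℕ f)
    at-index f
      rewrite frame-lookup (update W Rs i b) f | frame-lookup Rs f
      = mk⇔ (λ h → let Rx , b⋠x = to (lookup-update Rs i b f x) h in Rx , λ 1≤f f≤i _ → b⋠x 1≤f f≤i)
            (λ (Rx , b⋠x) → from (lookup-update Rs i b f x) (Rx , λ 1≤f f≤i → b⋠x 1≤f f≤i (≤-pred (toℕ<n f))))

  module _ (P : Pred W) where
    open Rules W P

    record Invariant {N} (Rs : Frames W N) : Set where
      field
        I⊆R₀       : ∀ x → InI W x → frame Rs 0 x
        R₀⊆↓I      : ∀ x → frame Rs 0 x → mem (downI W) x
        Rₖ⊆Rₖ₊₁     : ∀ k x → frame Rs k x → frame Rs (suc k) x
        postRₖ⊆Rₖ₊₁ : ∀ k x y → frame Rs k x → x ⟶ y → frame Rs (suc k) y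
        Rₖ⊆P       : ∀ k → k < N → ∀ x → frame Rs k x → P x

      frame-mono : ∀ {k l} → k ≤ l → ∀ x → frame Rs k x → frame Rs l x
      frame-mono {l = zero}  z≤n    _ Rₖx = Rₖx
      frame-mono {l = suc l} k≤1+l x Rₖx with m≤n⇒m<n∨m≡n k≤1+l
      ... | inj₁ k<1+l = Rₖ⊆Rₖ₊₁ l x (frame-mono (≤-pred k<1+l) x Rₖx)
      ... | inj₂ refl  = Rₖx

      I⊆Rₖ : ∀ k x → InI W x → frame Rs k x
      I⊆Rₖ k x x∈I = frame-mono z≤n x (I⊆R₀ x x∈I)

      R₀∩↑b≡∅ : ∀ {b x} → ¬ (∃[ y ] (InI W y × b ≼ y)) → frame Rs 0 x → ¬ b ≼ x
      R₀∩↑b≡∅ ↑b∩I≡∅ R₀x b≼x =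
        let y , y∈I , x≼y = R₀⊆↓I _ R₀x in ↑b∩I≡∅ (y , y∈I , ≼-trans b≼x x≼y)

    open Invariant

    invariant-initial : Invariant (downI W ∷ [])
    invariant-initial = record
      { I⊆R₀       = λ x x∈I → x , x∈I , ≼-refl
      ; R₀⊆↓I      = λ _ R₀x → R₀x
      ; Rₖ⊆Rₖ₊₁     = λ k x _ → frame-beyond (downI W ∷ []) {suc k} (s≤s z≤n) x
      ; postRₖ⊆Rₖ₊₁ = λ k _ y _ _ → frame-beyond (downI W ∷ []) {suc k} (s≤s z≤n) y
      ; Rₖ⊆P       = λ _ ()
      }

    invariant-update : ∀ {N} {Rs : Frames W N} (j : Fin (suc N)) {a b} →
      Gen W (lookup Rs j) a b → Invariant Rs → Invariant (update W Rs (suc (toℕ j)) b)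
    invariant-update {N} {Rs} j {b = b} (_ , ↑b∩I≡∅ , pre↑b∩Rⱼ≡∅) inv = record
      { I⊆R₀       = λ x x∈I → from (frame-update Rs i b 0 x) (I⊆R₀ inv x x∈I , λ ())
      ; R₀⊆↓I      = λ x R′₀x → R₀⊆↓I inv x (old 0 x R′₀x)
      ; Rₖ⊆Rₖ₊₁     = λ k x R′ₖx → from (frame-update Rs i b (suc k) x)
          (Rₖ⊆Rₖ₊₁ inv k x (old k x R′ₖx) , λ _ k<i k<N → removed k x (<⇒≤ k<i) (<⇒≤ k<N) R′ₖx)
      ; postRₖ⊆Rₖ₊₁ = λ k x y R′ₖx x⟶y → from (frame-update Rs i b (suc k) y)
          (postRₖ⊆Rₖ₊₁ inv k x y (old k x R′ₖx) x⟶y , λ _ k<i k<N b≼y →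
            pre↑b∩Rⱼ≡∅ x (y , b≼y , x⟶y)
              ( subst (λ X → X x) (frame-lookup Rs j) (frame-mono inv (≤-pred k<i) x (old k x R′ₖx))
              , removed k x (<⇒≤ k<i) (<⇒≤ k<N) R′ₖx))
      ; Rₖ⊆P       = λ k k<N x R′ₖx → Rₖ⊆P inv k k<N x (old k x R′ₖx)
      }
      where
      i = suc (toℕ j)

      old : ∀ k x → frame (update W Rs i b) k x → frame Rs k x
      old k x R′ₖx = proj₁ (to (frame-update Rs i b k x) R′ₖx)

      removed : ∀ k x → k ≤ i → k ≤ N → frame (update W Rs i b) k x → ¬ b ≼ x
      removed zero    x _   _   R′₀x = R₀∩↑b≡∅ inv ↑b∩I≡∅ (old 0 x R′₀x)
      removed (suc k) x k<i k<N R′ₖx = proj₂ (to (frame-update Rs i b (suc k) x) R′ₖx) (s≤s z≤n) k<i k<N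


    invariant-unfold : ∀ {N} {Rs : Frames W N} →
      _⊆_ W (mem (last Rs)) P → Invariant Rs → Invariant (Rs ∷ʳ full W)
    invariant-unfold {N} {Rs} R_N⊆P inv = record
      { I⊆R₀       = λ x x∈I → new 0 x (I⊆R₀ inv x x∈I)
      ; R₀⊆↓I      = λ x R′₀x → R₀⊆↓I inv x (old 0 x R′₀x)
      ; Rₖ⊆Rₖ₊₁     = λ k x R′ₖx → new (suc k) x (Rₖ⊆Rₖ₊₁ inv k x (old k x R′ₖx))
      ; postRₖ⊆Rₖ₊₁ = λ k x y R′ₖx x⟶y → new (suc k) y (postRₖ⊆Rₖ₊₁ inv k x y (old k x R′ₖx) x⟶y)
      ; Rₖ⊆P       = R′ₖ⊆P
      }
      where
      old : ∀ k x → frame (Rs ∷ʳ full W) k x → frame Rs k x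
      old k x = subst (λ X → X x) (frame-∷ʳ-full Rs k)

      new : ∀ k x → frame Rs k x → frame (Rs ∷ʳ full W) k x
      new k x = subst (λ X → X x) (sym (frame-∷ʳ-full Rs k))

      R′ₖ⊆P : ∀ k → k < suc N → ∀ x → frame (Rs ∷ʳ full W) k x → P x
      R′ₖ⊆P k k<1+N x R′ₖx with m<1+n⇒m<n∨m≡n k<1+N
      ... | inj₁ k<N = Rₖ⊆P inv k k<N x (old k x R′ₖx)
      ... | inj₂ refl = R_N⊆P x (subst (λ X → X x) (frame-last Rs) (old N x R′ₖx))

    cover⊆P-of-fixpoint : ∀ {N} {Rs : Frames W N} (i : Fin N) →
      _≐_ W (mem (lookup Rs (inject₁ i))) (mem (lookup Rs (Fin.suc i))) →
      Invariant Rs → _⊆_ W (Cover W) P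
    cover⊆P-of-fixpoint {Rs = Rs} i Rᵢ≐Rᵢ₊₁ inv x Cover-x =
      Rₖ⊆P inv t (toℕ<n i) x
        (cover⊆inductive-invariant (frame-down Rs t) (I⊆Rₖ inv t) closed x Cover-x)
      where
      t = toℕ i

      Rₜ₊₁⊆Rₜ : ∀ y → frame Rs (suc t) y → frame Rs t y
      Rₜ₊₁⊆Rₜ y rewrite frame-lookup Rs (Fin.suc i) | sym (toℕ-inject₁ i) | frame-lookup Rs (inject₁ i) =
        proj₂ Rᵢ≐Rᵢ₊₁ y

      closed : ∀ x y → frame Rs t x → x ⟶ y → frame Rs t y
      closed x y Rₜx x⟶y = Rₜ₊₁⊆Rₜ y (postRₖ⊆Rₖ₊₁ inv t x y Rₜx x⟶y)

    Sound : RState W → Set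
    Sound init          = ⊤
    Sound valid         = _⊆_ W (Cover W) P
    Sound invalid       = ⊤
    Sound (conf _ Rs _) = Invariant Rs

    sound-step : ∀ {s t} → s ↦ t → Sound s → Sound t
    sound-step Initialize                   _   = invariant-initial
    sound-step (CandidateNondet _ _ _)      inv = inv
    sound-step (ModelSyn _ _)               _   = tt
    sound-step (ModelSem _ _ _ _)           _   = tt
    sound-step (DecideNondet _ _ _ _ _ _ _) inv = inv
    sound-step (Conflict _ j _ _ _ gen)     inv = invariant-update j gen inv
    sound-step (Induction i _ _ _ _ _ gen)  inv = invariant-update i gen inv
    sound-step (Valid i Rᵢ≐Rᵢ₊₁)            inv = cover⊆P-of-fixpoint i Rᵢ≐Rᵢ₊₁ inv
    sound-step (Unfold R_N⊆P)               inv = invariant-unfold R_N⊆P inv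

    sound-star : ∀ {s t} → s ↦* t → Sound s → Sound t
    sound-star ε              sound-s = sound-s
    sound-star (s↦s′ ◅ s′↦*t) sound-s = sound-star s′↦*t (sound-step s↦s′ sound-s)

theorem1 : (W : WSTS) (P : Pred W) → DownClosed W P →
    Rules._↦*_ W P (init {W}) (valid {W}) →
    _⊆_ W (Cover W) P
theorem1 W P _ init↦*valid = sound-star W P init↦*valid tt
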